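{- The reduction relation $\Longrightarrow$ on extended nominal $C$-unification problems generated by the simplification rules (del), (f), (f$^C$), ([a]), (ab), (var), (inst$_1$), (inst$_2$) is terminating.
   Context: Fix disjoint countably infinite sets of atoms and of variables, and a signature $\Sigma$ of term-formers with arities, some binary ones designated commutative and written $\mathsf f^C$. Nominal terms: $t::=a\mid\pi\cdot X\mid\mathsf f(t_1,\ldots,t_n)\mid[a]t$ where $\pi$ is a finite permutation of atoms; the permutation action on terms is $\pi\cdot a=\pi(a)$, $\pi\cdot(\pi'\cdot X)=(\pi\circ\pi')\cdot X$, $\pi\cdot[a]t=[\pi(a)](\pi\cdot t)$, $\pi\cdot\mathsf f(\vec t)=\mathsf f(\pi\cdot\vec t)$; $\mathrm{var}(t)$ is the set of variables of $t$; $(a\ b)$ is a swapping. A nominal $C$-unification problem is $\mathsf{N}\bar c.Pr$ with $\bar c$ a finite list of names and $Pr$ a finite set of constraints $s\approx_C^? t$; an extended problem is a finite set of such problems, and a step of $\Longrightarrow$ replaces one problem of the set by its result(s) under one rule: (del) $\mathsf N\bar c.Pr\uplus\{t\approx^?_C t\}\Rightarrow\mathsf N\bar c.Pr$; (f) for non-commutative $\mathsf f$, $\mathsf N\bar c.Pr\uplus\{\mathsf f(t_1..t_n)\approx^?_C\mathsf f(t'_1..t'_n)\}\Rightarrow\mathsf N\bar c.Pr\cup\{t_i\approx^?_C t_i'\}_{i}$; (f$^C$) $\mathsf N\bar c.Pr\uplus\{\mathsf f^C(t_0,t_1)\approx^?_C\mathsf f^C(s_0,s_1)\}$ is replaced by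 the two problems $\mathsf N\bar c.Pr\cup\{t_0\approx^?_C s_0,t_1\approx^?_C s_1\}$ and $\mathsf N\bar c.Pr\cup\{t_0\approx^?_C s_1,t_1\approx^?_C s_0\}$; ([a]) $\mathsf N\bar c.Pr\uplus\{[a]t\approx^?_C[a]t'\}\Rightarrow\mathsf N\bar c.Pr\cup\{t\approx^?_C t'\}$; (ab) $\mathsf N\bar c.Pr\uplus\{[a]t\approx^?_C[b]t'\}\Rightarrow\mathsf N\bar c,c_1.Pr\cup\{(a\ c_1)\cdot t\approx^?_C(b\ c_1)\cdot t'\}$ with $c_1$ a new name; (var) $\mathsf N\bar c.Pr\uplus\{\pi\cdot X\approx^?_C\pi'\cdot X\}\Rightarrow\mathsf N\bar c.Pr\cup\{(\pi'^{ -1}\circ\pi)\cdot X\approx^?_C X\}$ if $\pi'\ne\mathrm{id}$; (inst$_1$) $\mathsf N\bar c.Pr\uplus\{\pi\cdot X\approx^?_C t\}\Rightarrow\mathsf N\bar c.Pr[X\mapsto\pi^{ -1}\cdot t]$ if $X\notin\mathrm{var}(t)$; (inst$_2$) $\mathsf N\bar c.Pr\uplus\{t\approx^?_C\pi\cdot X\}\Rightarrow\mathsf N\bar c.Pr[X\mapsto\pi^{ -1}\cdot t]$ if $X\notin\mathrm{var}(t)$. (Substitutions apply homomorphically with $(\pi\cdot X)\sigma=\pi\cdot(X\sigma)$.) -}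

module Defs where

open import Data.Nat using (ℕ; _≟_)
open import Data.Product using (_×_; _,_; Σ-syntax)
open import Data.List using (List; []; _∷_; _++_; map; reverse; concat)
open import Data.List.Membership.Propositional using (_∈_; _∉_)
open import Data.List.Relation.Unary.All using (All)
open import Data.List.Relation.Binary.Permutation.Propositional using (_↭_)
open import Data.Vec using (Vec; []; _∷_)
open import Relation.Nullary using (¬_; yes; no)
open import Relation.Binary.PropositionalEquality using (_≡_; _≢_)

-- Atoms and variables: two disjoint countably infinite sorts.

Atom : Set
Atom = ℕ

Var : Set
Var = ℕ

-- Finite permutations of atoms, represented as lists of swappings
-- (a b); the list (s₁ ∷ s₂ ∷ … ∷ sₙ ∷ []) denotes s₁ ∘ s₂ ∘ … ∘ sₙ.

Perm : Set
Perm = List (Atom × Atom)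

swapAtom : Atom → Atom → Atom → Atom
swapAtom a b c with c ≟ a
... | yes _ = b
... | no _ with c ≟ b
...   | yes _ = a
...   | no _ = c

apply : Perm → Atom → Atom
apply [] c = c
apply ((a , b) ∷ π) c = swapAtom a b (apply π c)

_∘ₚ_ : Perm → Perm → Perm
π ∘ₚ π' = π ++ π'

_⁻¹ : Perm → Perm
π ⁻¹ = reverse π

IsId : Perm → Set
IsId π = ∀ a → apply π a ≡ a

-- Signature: non-commutative term-formers with arities, and
-- (binary) commutative term-formers f^C.

record Signature : Set₁ where
  field
    FSym  : Set
    arity : FSym → ℕ
    CSym  : Set

open Signature public

data Term (S : Signature) : Set where
  atom : Atom → Term S
  susp : Perm → Var → Term S
  fun  : (f : FSym S) → Vec (Term S) (arity S f) → Term S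
  funC : CSym S → Term S → Term S → Term S
  abs  : Atom → Term S → Term S

module _ {S : Signature} where

  _·_ : Perm → Term S → Term S
  _·ᵛ_ : ∀ {n} → Perm → Vec (Term S) n → Vec (Term S) n
  π · atom a = atom (apply π a)
  π · susp π' X = susp (π ∘ₚ π') X
  π · fun f ts = fun f (π ·ᵛ ts)
  π · funC g t u = funC g (π · t) (π · u)
  π · abs a t = abs (apply π a) (π · t)
  π ·ᵛ [] = []
  π ·ᵛ (t ∷ ts) = (π · t) ∷ (π ·ᵛ ts)

  vars : Term S → List Var
  varsᵛ : ∀ {n} → Vec (Term S) n → List Var
  vars (atom a) = []
  vars (susp π X) = X ∷ []
  vars (fun f ts) = varsᵛ ts
  vars (funC g t u) = vars t ++ vars u
  vars (abs a t) = vars t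
  varsᵛ [] = []
  varsᵛ (t ∷ ts) = vars t ++ varsᵛ ts

  permAtoms : Perm → List Atom
  permAtoms [] = []
  permAtoms ((a , b) ∷ π) = a ∷ b ∷ permAtoms π

  atoms : Term S → List Atom
  atomsᵛ : ∀ {n} → Vec (Term S) n → List Atom
  atoms (atom a) = a ∷ []
  atoms (susp π X) = permAtoms π
  atoms (fun f ts) = atomsᵛ ts
  atoms (funC g t u) = atoms t ++ atoms u
  atoms (abs a t) = a ∷ atoms t
  atomsᵛ [] = []
  atomsᵛ (t ∷ ts) = atoms t ++ atomsᵛ ts

  _[_↦_] : Term S → Var → Term S → Term S
  substᵛ : ∀ {n} → Vec (Term S) n → Var → Term S → Vec (Term S) n
  atom a [ X ↦ s ] = atom a
  susp π Y [ X ↦ s ] with Y ≟ X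
  ... | yes _ = π · s
  ... | no _ = susp π Y
  fun f ts [ X ↦ s ] = fun f (substᵛ ts X s)
  funC g t u [ X ↦ s ] = funC g (t [ X ↦ s ]) (u [ X ↦ s ])
  abs a t [ X ↦ s ] = abs a (t [ X ↦ s ])
  substᵛ [] X s = []
  substᵛ (t ∷ ts) X s = (t [ X ↦ s ]) ∷ substᵛ ts X s

record Constraint (S : Signature) : Set where
  constructor _≈?_
  field
    lhs : Term S
    rhs : Term S

record Problem (S : Signature) : Set where
  constructor N_∙_
  field
    names : List Atom
    cs    : List (Constraint S)

ExtProblem : Signature → Set
ExtProblem S = List (Problem S)

module _ {S : Signature} where

  substC : Constraint S → Var → Term S → Constraint S
  substC (l ≈? r) X s = (l [ X ↦ s ]) ≈? (r [ X ↦ s ])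

  substPr : List (Constraint S) → Var → Term S → List (Constraint S)
  substPr Pr X s = map (λ c → substC c X s) Pr

  constraintAtoms : Constraint S → List Atom
  constraintAtoms (l ≈? r) = atoms l ++ atoms r

  prAtoms : List (Constraint S) → List Atom
  prAtoms Pr = concat (map constraintAtoms Pr)

  zipC : ∀ {n} → Vec (Term S) n → Vec (Term S) n → List (Constraint S)
  zipC [] [] = []
  zipC (t ∷ ts) (u ∷ us) = (t ≈? u) ∷ zipC ts us

  -- One simplification rule applied to a single problem, producing the
  -- list of resulting problems.  "Pr ⊎ {c}" is rendered as  Pr ↭ c ∷ Pr'.
  data _↝_ : Problem S → List (Problem S) → Set where
    del   : ∀ {c̄ Pr Pr'} t →
            Pr ↭ (t ≈? t) ∷ Pr' →
            (N c̄ ∙ Pr) ↝ ((N c̄ ∙ Pr') ∷ [])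
    f     : ∀ {c̄ Pr Pr'} (g : FSym S) (ts us : Vec (Term S) (arity S g)) →
            Pr ↭ (fun g ts ≈? fun g us) ∷ Pr' →
            (N c̄ ∙ Pr) ↝ ((N c̄ ∙ (Pr' ++ zipC ts us)) ∷ [])
    fC    : ∀ {c̄ Pr Pr'} (g : CSym S) t₀ t₁ s₀ s₁ →
            Pr ↭ (funC g t₀ t₁ ≈? funC g s₀ s₁) ∷ Pr' →
            (N c̄ ∙ Pr) ↝ ((N c̄ ∙ (Pr' ++ (t₀ ≈? s₀) ∷ (t₁ ≈? s₁) ∷ []))
                         ∷ (N c̄ ∙ (Pr' ++ (t₀ ≈? s₁) ∷ (t₁ ≈? s₀) ∷ []))
                         ∷ [])
    absA  : ∀ {c̄ Pr Pr'} a t t' →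
            Pr ↭ (abs a t ≈? abs a t') ∷ Pr' →
            (N c̄ ∙ Pr) ↝ ((N c̄ ∙ (Pr' ++ (t ≈? t') ∷ [])) ∷ [])
    absAB : ∀ {c̄ Pr Pr'} a b t t' c₁ →
            a ≢ b →
            Pr ↭ (abs a t ≈? abs b t') ∷ Pr' →
            c₁ ∉ c̄ → c₁ ∉ prAtoms Pr →
            (N c̄ ∙ Pr) ↝
              ((N (c̄ ++ c₁ ∷ []) ∙
                  (Pr' ++ ((((a , c₁) ∷ []) · t) ≈? (((b , c₁) ∷ []) · t')) ∷ []))
               ∷ [])
    var   : ∀ {c̄ Pr Pr'} π π' X →
            ¬ IsId π' →
            Pr ↭ (susp π X ≈? susp π' X) ∷ Pr' →
            (N c̄ ∙ Pr) ↝
              ((N c̄ ∙ (Pr' ++ (susp ((π' ⁻¹) ∘ₚ π) X ≈? susp [] X) ∷ [])) ∷ [])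
    inst₁ : ∀ {c̄ Pr Pr'} π X t →
            X ∉ vars t →
            Pr ↭ (susp π X ≈? t) ∷ Pr' →
            (N c̄ ∙ Pr) ↝ ((N c̄ ∙ substPr Pr' X ((π ⁻¹) · t)) ∷ [])
    inst₂ : ∀ {c̄ Pr Pr'} π X t →
            X ∉ vars t →
            Pr ↭ (t ≈? susp π X) ∷ Pr' →
            (N c̄ ∙ Pr) ↝ ((N c̄ ∙ substPr Pr' X ((π ⁻¹) · t)) ∷ [])

  data _⟹_ : ExtProblem S → ExtProblem S → Set where
    step : ∀ {P Ps E E'} →
           E ↭ P ∷ E' → P ↝ Ps →
           E ⟹ (E' ++ Ps)

module Submission where

-- A problem is measured by the number of distinct variables in its constraints,
-- then by its weight, the total size of all constraint sides. (inst₁)/(inst₂)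
-- eliminate a variable; every other rule replaces one constraint by constraints
-- with no new variables and smaller total weight. So each step replaces one
-- member of the extended problem by finitely many smaller problems, and such
-- replacements terminate on finite multisets over a well-founded order
-- (Dershowitz–Manna): induct on the replaced problem, then on the rest.

open import Defs
open import Function using (flip; _∘_; _on_)
open import Induction.WellFounded using (WellFounded; Acc; acc; module Subrelation)
open import Algebra.Bundles using (CommutativeMonoid)
open import Data.Nat using (ℕ; suc; _+_; _≤_; _<_; z≤n; s≤s; z<s)
open import Data.Nat.Properties
  using (+-mono-≤; +-monoʳ-≤; +-monoʳ-<; +-mono-<; +-comm; +-identityʳ; m≤m+n; n<1+n;
         <-≤-trans; ≤-reflexive; ≤-refl; m≤n⇒m<n∨m≡n; +-commutativeSemigroup; module ≤-Reasoning)
import Data.Nat as ℕ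
open import Data.Nat.Induction using (<-wellFounded)
open import Data.Nat.ListAction using (sum)
open import Data.Nat.ListAction.Properties using (sum-++; sum-↭)
open import Data.Product using (_×_; _,_; proj₁; ∃-syntax)
import Data.Product as Product
open import Data.Product.Relation.Binary.Lex.Strict using (×-Lex; ×-wellFounded)
open import Data.Sum using (_⊎_; inj₁; inj₂; [_,_])
import Data.Sum as Sum
open import Data.List using (List; []; _∷_; _++_; map; length; concatMap; deduplicate)
open import Data.List.Properties using (map-++; concatMap-++)
import Data.List.Properties as List
open import Data.List.Membership.Propositional using (_∈_; _∉_)
open import Data.List.Membership.Propositional.Properties
  using (∈-++⁺ˡ; ∈-++⁺ʳ; ∈-++⁻; ∈-∃++; ∈-deduplicate⁺; ∈-deduplicate⁻)
open import Data.List.Relation.Unary.Any using (here; there)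
open import Data.List.Relation.Unary.All using (All; []; _∷_)
open import Data.List.Relation.Unary.All.Properties using (All¬⇒¬Any; ¬Any⇒All¬)
open import Data.List.Relation.Unary.Unique.Propositional using (Unique)
open import Data.List.Relation.Unary.AllPairs using ([]; _∷_)
open import Data.List.Relation.Binary.Subset.Propositional using (_⊆_)
open import Data.List.Relation.Binary.Subset.Propositional.Properties
  using (⊆-refl; ⊆-reflexive; ⊆-reflexive-↭; ⊆-respʳ-↭; ⊆∷∧∉⇒⊆; concatMap⁺)
import Data.List.Relation.Binary.Subset.Propositional.Properties as ⊆
open import Data.List.Relation.Binary.Permutation.Propositional
  using (_↭_; ↭-refl; ↭-reflexive; ↭-sym; ↭-trans)
open import Data.List.Relation.Binary.Permutation.Propositional.Properties
  using (shift; drop-∷; drop-mid; ++⁺ˡ; ++⁺ʳ; ++-comm; ++-commutativeMonoid;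
         ∈-resp-↭; ¬x∷xs↭[]; ↭-length; map⁺)
open import Data.Vec using (Vec; []; _∷_)
open import Relation.Binary.Construct.On as On using ()
open import Relation.Binary.Definitions using (DecidableEquality)
open import Relation.Binary.PropositionalEquality
  using (_≡_; _≢_; refl; trans; cong; cong₂; subst)
open import Relation.Nullary using (¬_; yes; no; contradiction)
open import Algebra.Properties.CommutativeSemigroup +-commutativeSemigroup
  using () renaming (interchange to +-interchange)
open import Algebra.Properties.CommutativeSemigroup
  (CommutativeMonoid.commutativeSemigroup (++-commutativeMonoid {A = Var}))
  using () renaming (interchange to ++-interchange)

∷↭∷-inv : ∀ {A : Set} {x y : A} {xs ys} → x ∷ xs ↭ y ∷ ys →
          (x ≡ y × xs ↭ ys) ⊎ ∃[ zs ] (xs ↭ y ∷ zs × ys ↭ x ∷ zs)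
∷↭∷-inv {x = x} {y} p with ∈-resp-↭ (↭-sym p) (here refl)
... | here refl = inj₁ (refl , drop-∷ p)
... | there y∈xs with ∈-∃++ y∈xs
...   | as , bs , refl = inj₂ (as ++ bs , shift y as bs , ↭-sym (drop-mid (x ∷ as) [] p))

module Replacement {A : Set} (_↝_ : A → List A → Set) where

  data _⇒_ : List A → List A → Set where
    replace : ∀ {x ys E E'} → E ↭ x ∷ E' → x ↝ ys → E ⇒ (E' ++ ys)

  Acc-resp-↭ : ∀ {E F} → E ↭ F → Acc (flip _⇒_) E → Acc (flip _⇒_) F
  Acc-resp-↭ E↭F (acc rs) = acc λ { (replace F↭ r) → rs (replace (↭-trans E↭F F↭) r) }

  module _ {_≺_ : A → A → Set} (≺-wellFounded : WellFounded _≺_)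
           (↝-decreasing : ∀ {x ys} → x ↝ ys → All (_≺ x) ys) where

    Acc-∷-step : ∀ {x E} →
                 (∀ {y F} → y ≺ x → Acc (flip _⇒_) F → Acc (flip _⇒_) (y ∷ F)) →
                 (∀ {F} → E ⇒ F → Acc (flip _⇒_) (x ∷ F)) →
                 Acc (flip _⇒_) E → ∀ {G} → (x ∷ E) ⇒ G → Acc (flip _⇒_) G
    Acc-∷-step {x} {E} ih≺ ih⇒ accE (replace {ys = ys} x∷E↭ r) with ∷↭∷-inv x∷E↭
    ... | inj₁ (refl , E↭E') =
      Acc-resp-↭ (↭-trans (++-comm ys E) (++⁺ʳ ys E↭E')) (Acc-++ (↝-decreasing r))
      where
      Acc-++ : ∀ {ys} → All (_≺ x) ys → Acc (flip _⇒_) (ys ++ E)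
      Acc-++ []           = accE
      Acc-++ (y≺x ∷ ys≺x) = ih≺ y≺x (Acc-++ ys≺x)
    ... | inj₂ (E'' , E↭ , E'↭) = Acc-resp-↭ (↭-sym (++⁺ʳ ys E'↭)) (ih⇒ (replace E↭ r))

    Acc-∷ : ∀ {x E} → Acc _≺_ x → Acc (flip _⇒_) E → Acc (flip _⇒_) (x ∷ E)
    Acc-∷ (acc rs≺) (acc rsE) =
      acc (Acc-∷-step (λ y≺x → Acc-∷ (rs≺ y≺x)) (λ E⇒F → Acc-∷ (acc rs≺) (rsE E⇒F)) (acc rsE))

    ⇒-wellFounded : WellFounded (flip _⇒_)
    ⇒-wellFounded []      = acc λ { (replace []↭ _) → contradiction (↭-sym []↭) ¬x∷xs↭[] }
    ⇒-wellFounded (x ∷ E) = Acc-∷ (≺-wellFounded x) (⇒-wellFounded E)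

module DistinctCount {A : Set} (_≟_ : DecidableEquality A) where

  open import Data.List.Relation.Unary.Unique.DecPropositional.Properties _≟_ using (deduplicate-!)

  Unique-⊆⇒length≤ : ∀ {xs ys : List A} → Unique xs → xs ⊆ ys → length xs ≤ length ys
  Unique-⊆⇒length≤ {[]}     _              _        = z≤n
  Unique-⊆⇒length≤ {x ∷ xs} (x∉xs ∷ !xs) x∷xs⊆ys with ∈-∃++ (x∷xs⊆ys (here refl))
  ... | as , bs , refl = begin
    suc (length xs)         ≤⟨ s≤s (Unique-⊆⇒length≤ !xs xs⊆as++bs) ⟩
    suc (length (as ++ bs)) ≡⟨ ↭-length (shift x as bs) ⟨
    length (as ++ x ∷ bs)   ∎
    where
    open ≤-Reasoning
    xs⊆as++bs : xs ⊆ as ++ bs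
    xs⊆as++bs = ⊆∷∧∉⇒⊆ (⊆-respʳ-↭ (shift x as bs) (x∷xs⊆ys ∘ there)) (All¬⇒¬Any x∉xs)

  card : List A → ℕ
  card xs = length (deduplicate _≟_ xs)

  card-mono : ∀ {xs ys} → xs ⊆ ys → card xs ≤ card ys
  card-mono {xs} xs⊆ys =
    Unique-⊆⇒length≤ (deduplicate-! xs) (∈-deduplicate⁺ _≟_ ∘ xs⊆ys ∘ ∈-deduplicate⁻ _≟_ xs)

  card-mono-< : ∀ {xs ys y} → xs ⊆ ys → y ∈ ys → y ∉ xs → card xs < card ys
  card-mono-< {xs} xs⊆ys y∈ys y∉xs =
    Unique-⊆⇒length≤ (¬Any⇒All¬ _ (y∉xs ∘ ∈-deduplicate⁻ _≟_ xs) ∷ deduplicate-! xs)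
      λ { (here refl) → ∈-deduplicate⁺ _≟_ y∈ys
        ; (there y∈) → ∈-deduplicate⁺ _≟_ (xs⊆ys (∈-deduplicate⁻ _≟_ xs y∈)) }

open DistinctCount ℕ._≟_

infix 4 _⊆_∖_∪_
_⊆_∖_∪_ : List Var → List Var → Var → List Var → Set
ys ⊆ xs ∖ X ∪ zs = ∀ {Y} → Y ∈ ys → (Y ∈ xs × Y ≢ X) ⊎ Y ∈ zs

++⁺-∖∪ : ∀ {ys ys' xs xs' X zs} → ys ⊆ xs ∖ X ∪ zs → ys' ⊆ xs' ∖ X ∪ zs →
         ys ++ ys' ⊆ xs ++ xs' ∖ X ∪ zs
++⁺-∖∪ {ys} {xs = xs} ys⊆ ys'⊆ Y∈ with ∈-++⁻ ys Y∈
... | inj₁ Y∈ys  = Sum.map₁ (Product.map₁ ∈-++⁺ˡ) (ys⊆ Y∈ys)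
... | inj₂ Y∈ys' = Sum.map₁ (Product.map₁ (∈-++⁺ʳ xs)) (ys'⊆ Y∈ys')

module _ {S : Signature} where

  size : Term S → ℕ
  sizeᵛ : ∀ {n} → Vec (Term S) n → ℕ
  size (atom a)     = 1
  size (susp π X)   = 2
  size (fun g ts)   = suc (sizeᵛ ts)
  size (funC g t u) = suc (size t + size u)
  size (abs a t)    = suc (size t)
  sizeᵛ []       = 0
  sizeᵛ (t ∷ ts) = size t + sizeᵛ ts

  -- (var) changes neither variables nor sizes, it only makes the right-hand side
  -- an identity suspension; counting that as 1 instead of 2 makes (var) decrease.
  rhsSize : Term S → ℕ
  rhsSize (susp [] X) = 1
  rhsSize t           = size t

  rhsSize≤size : ∀ t → rhsSize t ≤ size t
  rhsSize≤size (atom a)         = ≤-refl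
  rhsSize≤size (susp [] X)      = s≤s z≤n
  rhsSize≤size (susp (_ ∷ _) X) = ≤-refl
  rhsSize≤size (fun g ts)       = ≤-refl
  rhsSize≤size (funC g t u)     = ≤-refl
  rhsSize≤size (abs a t)        = ≤-refl

  size>0 : ∀ t → 0 < size t
  size>0 (atom a)     = z<s
  size>0 (susp π X)   = z<s
  size>0 (fun g ts)   = z<s
  size>0 (funC g t u) = z<s
  size>0 (abs a t)    = z<s

  size-· : ∀ π t → size (π · t) ≡ size t
  sizeᵛ-· : ∀ {n} π (ts : Vec (Term S) n) → sizeᵛ (π ·ᵛ ts) ≡ sizeᵛ ts
  size-· π (atom a)     = refl
  size-· π (susp π' X)  = refl
  size-· π (fun g ts)   = cong suc (sizeᵛ-· π ts)
  size-· π (funC g t u) = cong suc (cong₂ _+_ (size-· π t) (size-· π u))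
  size-· π (abs a t)    = cong suc (size-· π t)
  sizeᵛ-· π []       = refl
  sizeᵛ-· π (t ∷ ts) = cong₂ _+_ (size-· π t) (sizeᵛ-· π ts)

  vars-· : ∀ π t → vars (π · t) ≡ vars t
  varsᵛ-· : ∀ {n} π (ts : Vec (Term S) n) → varsᵛ (π ·ᵛ ts) ≡ varsᵛ ts
  vars-· π (atom a)     = refl
  vars-· π (susp π' X)  = refl
  vars-· π (fun g ts)   = varsᵛ-· π ts
  vars-· π (funC g t u) = cong₂ _++_ (vars-· π t) (vars-· π u)
  vars-· π (abs a t)    = vars-· π t
  varsᵛ-· π []       = refl
  varsᵛ-· π (t ∷ ts) = cong₂ _++_ (vars-· π t) (varsᵛ-· π ts)

  vars-·-⊆ : ∀ π t → vars (π · t) ⊆ vars t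
  vars-·-⊆ π t = subst (_ ∈_) (vars-· π t)

  vars-[↦] : ∀ u X s → vars (u [ X ↦ s ]) ⊆ vars u ∖ X ∪ vars s
  varsᵛ-[↦] : ∀ {n} (us : Vec (Term S) n) X s → varsᵛ (substᵛ us X s) ⊆ varsᵛ us ∖ X ∪ vars s
  vars-[↦] (atom a) X s ()
  vars-[↦] (susp π Z) X s Y∈ with Z ℕ.≟ X
  ... | yes _ = inj₂ (vars-·-⊆ π s Y∈)
  ... | no Z≢X with Y∈
  ...   | here refl = inj₁ (here refl , Z≢X)
  vars-[↦] (fun g ts)   X s = varsᵛ-[↦] ts X s
  vars-[↦] (funC g t u) X s = ++⁺-∖∪ (vars-[↦] t X s) (vars-[↦] u X s)
  vars-[↦] (abs a t)    X s = vars-[↦] t X s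
  varsᵛ-[↦] []       X s ()
  varsᵛ-[↦] (t ∷ ts) X s = ++⁺-∖∪ (vars-[↦] t X s) (varsᵛ-[↦] ts X s)

  constraintVars : Constraint S → List Var
  constraintVars (l ≈? r) = vars l ++ vars r

  constraintSize : Constraint S → ℕ
  constraintSize (l ≈? r) = size l + size r

  constraintWeight : Constraint S → ℕ
  constraintWeight (l ≈? r) = size l + rhsSize r

  problemVars : List (Constraint S) → List Var
  problemVars = concatMap constraintVars

  problemSize : List (Constraint S) → ℕ
  problemSize cs = sum (map constraintSize cs)

  problemWeight : List (Constraint S) → ℕ
  problemWeight cs = sum (map constraintWeight cs)

  problemWeight≤problemSize : ∀ cs → problemWeight cs ≤ problemSize cs
  problemWeight≤problemSize []             = z≤n
  problemWeight≤problemSize ((l ≈? r) ∷ cs) =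
    +-mono-≤ (+-monoʳ-≤ (size l) (rhsSize≤size r)) (problemWeight≤problemSize cs)

  problemWeight-++ : ∀ cs ds → problemWeight (cs ++ ds) ≡ problemWeight cs + problemWeight ds
  problemWeight-++ cs ds =
    trans (cong sum (map-++ constraintWeight cs ds))
          (sum-++ (map constraintWeight cs) (map constraintWeight ds))

  problemVars-substPr : ∀ Pr X s → problemVars (substPr Pr X s) ⊆ problemVars Pr ∖ X ∪ vars s
  problemVars-substPr []              X s ()
  problemVars-substPr ((l ≈? r) ∷ Pr) X s =
    ++⁺-∖∪ (++⁺-∖∪ (vars-[↦] l X s) (vars-[↦] r X s)) (problemVars-substPr Pr X s)

  module _ {Pr Pr' : List (Constraint S)} {c : Constraint S} (Pr↭ : Pr ↭ c ∷ Pr') where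

    constraintVars⊆ : constraintVars c ⊆ problemVars Pr
    constraintVars⊆ = concatMap⁺ constraintVars (⊆-reflexive-↭ (↭-sym Pr↭)) ∘ ∈-++⁺ˡ

    problemVars⊆ : problemVars Pr' ⊆ problemVars Pr
    problemVars⊆ = concatMap⁺ constraintVars (⊆-reflexive-↭ (↭-sym Pr↭)) ∘ ∈-++⁺ʳ (constraintVars c)

    problemWeight-↭ : problemWeight Pr ≡ constraintWeight c + problemWeight Pr'
    problemWeight-↭ = sum-↭ (map⁺ constraintWeight Pr↭)

  problemVars-zipC : ∀ {n} (ts us : Vec (Term S) n) → problemVars (zipC ts us) ↭ varsᵛ ts ++ varsᵛ us
  problemVars-zipC []       []       = ↭-refl
  problemVars-zipC (t ∷ ts) (u ∷ us) =
    ↭-trans (++⁺ˡ (vars t ++ vars u) (problemVars-zipC ts us))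
            (++-interchange (vars t) (vars u) (varsᵛ ts) (varsᵛ us))

  problemSize-zipC : ∀ {n} (ts us : Vec (Term S) n) → problemSize (zipC ts us) ≡ sizeᵛ ts + sizeᵛ us
  problemSize-zipC []       []       = refl
  problemSize-zipC (t ∷ ts) (u ∷ us) =
    trans (cong (size t + size u +_) (problemSize-zipC ts us))
          (+-interchange (size t) (size u) (sizeᵛ ts) (sizeᵛ us))

  measure : List (Constraint S) → ℕ × ℕ
  measure Pr = card (problemVars Pr) , problemWeight Pr

  _⊏_ : List (Constraint S) → List (Constraint S) → Set
  _⊏_ = ×-Lex _≡_ _<_ _<_ on measure

  _≺_ : Problem S → Problem S → Set
  _≺_ = _⊏_ on Problem.cs

  ≺-wellFounded : WellFounded _≺_
  ≺-wellFounded =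
    On.wellFounded Problem.cs (On.wellFounded measure (×-wellFounded <-wellFounded <-wellFounded))

  record _⊳_ (c : Constraint S) (cs : List (Constraint S)) : Set where
    field
      vars-⊆   : problemVars cs ⊆ constraintVars c
      weight-< : problemWeight cs < constraintWeight c

  ⊳-⊏ : ∀ {Pr Pr' c cs} → Pr ↭ c ∷ Pr' → c ⊳ cs → (Pr' ++ cs) ⊏ Pr
  ⊳-⊏ {Pr} {Pr'} {c} {cs} Pr↭ c⊳cs =
    [ inj₁ , (λ same → inj₂ (same , lighter)) ] (m≤n⇒m<n∨m≡n (card-mono vars⊆))
    where
    open _⊳_ c⊳cs
    vars⊆ : problemVars (Pr' ++ cs) ⊆ problemVars Pr
    vars⊆ Y∈ rewrite concatMap-++ constraintVars Pr' cs =
      [ problemVars⊆ Pr↭ , constraintVars⊆ Pr↭ ∘ vars-⊆ ] (∈-++⁻ (problemVars Pr') Y∈)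
    lighter : problemWeight (Pr' ++ cs) < problemWeight Pr
    lighter = begin-strict
      problemWeight (Pr' ++ cs)                  ≡⟨ problemWeight-++ Pr' cs ⟩
      problemWeight Pr' + problemWeight cs       <⟨ +-monoʳ-< (problemWeight Pr') weight-< ⟩
      problemWeight Pr' + constraintWeight c     ≡⟨ +-comm (problemWeight Pr') _ ⟩
      constraintWeight c + problemWeight Pr'     ≡⟨ problemWeight-↭ Pr↭ ⟨
      problemWeight Pr                           ∎
      where open ≤-Reasoning

  eliminate-⊏ : ∀ {Pr Pr' c X s} → Pr ↭ c ∷ Pr' → X ∈ constraintVars c →
                vars s ⊆ constraintVars c → X ∉ vars s → substPr Pr' X s ⊏ Pr
  eliminate-⊏ {Pr' = Pr'} {X = X} {s} Pr↭ X∈c s⊆c X∉s =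
    inj₁ (card-mono-< vars⊆ (constraintVars⊆ Pr↭ X∈c) X∉)
    where
    vars⊆ : problemVars (substPr Pr' X s) ⊆ _
    vars⊆ Y∈ =
      [ problemVars⊆ Pr↭ ∘ proj₁ , constraintVars⊆ Pr↭ ∘ s⊆c ] (problemVars-substPr Pr' X s Y∈)
    X∉ : X ∉ problemVars (substPr Pr' X s)
    X∉ X∈ = [ (λ (_ , X≢X) → X≢X refl) , X∉s ] (problemVars-substPr Pr' X s X∈)

  varsᵛ-pair : ∀ (t u : Term S) → varsᵛ (t ∷ u ∷ []) ≡ vars t ++ vars u
  varsᵛ-pair t u = cong (vars t ++_) (List.++-identityʳ (vars u))

  sizeᵛ-pair : ∀ (t u : Term S) → sizeᵛ (t ∷ u ∷ []) ≡ size t + size u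
  sizeᵛ-pair t u = cong (size t +_) (+-identityʳ (size u))

  zipC-⊳ : ∀ {n l r} (ts us : Vec (Term S) n) → varsᵛ ts ⊆ vars l → varsᵛ us ⊆ vars r →
           sizeᵛ ts < size l → sizeᵛ us < rhsSize r → (l ≈? r) ⊳ zipC ts us
  zipC-⊳ {l = l} {r} ts us ts⊆l us⊆r ts<l us<r = record
    { vars-⊆   = ⊆.++⁺ ts⊆l us⊆r ∘ ∈-resp-↭ (problemVars-zipC ts us)
    ; weight-< = begin-strict
        problemWeight (zipC ts us) ≤⟨ problemWeight≤problemSize (zipC ts us) ⟩
        problemSize (zipC ts us)   ≡⟨ problemSize-zipC ts us ⟩
        sizeᵛ ts + sizeᵛ us        <⟨ +-mono-< ts<l us<r ⟩
        size l + rhsSize r         ∎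
    }
    where open ≤-Reasoning

  del-⊳ : ∀ t → (t ≈? t) ⊳ []
  del-⊳ t = record { vars-⊆ = λ () ; weight-< = <-≤-trans (size>0 t) (m≤m+n (size t) (rhsSize t)) }

  f-⊳ : ∀ g (ts us : Vec (Term S) (arity S g)) → (fun g ts ≈? fun g us) ⊳ zipC ts us
  f-⊳ g ts us = zipC-⊳ ts us ⊆-refl ⊆-refl (n<1+n _) (n<1+n _)

  fC-⊳ : ∀ g (t₀ t₁ s₀ s₁ : Term S) →
         (funC g t₀ t₁ ≈? funC g s₀ s₁) ⊳ zipC (t₀ ∷ t₁ ∷ []) (s₀ ∷ s₁ ∷ [])
  fC-⊳ g t₀ t₁ s₀ s₁ =
    zipC-⊳ (t₀ ∷ t₁ ∷ []) (s₀ ∷ s₁ ∷ [])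
      (⊆-reflexive (varsᵛ-pair t₀ t₁)) (⊆-reflexive (varsᵛ-pair s₀ s₁))
      (s≤s (≤-reflexive (sizeᵛ-pair t₀ t₁))) (s≤s (≤-reflexive (sizeᵛ-pair s₀ s₁)))

  fC-swap-⊳ : ∀ g (t₀ t₁ s₀ s₁ : Term S) →
              (funC g t₀ t₁ ≈? funC g s₀ s₁) ⊳ zipC (t₀ ∷ t₁ ∷ []) (s₁ ∷ s₀ ∷ [])
  fC-swap-⊳ g t₀ t₁ s₀ s₁ =
    zipC-⊳ (t₀ ∷ t₁ ∷ []) (s₁ ∷ s₀ ∷ [])
      (⊆-reflexive (varsᵛ-pair t₀ t₁))
      (⊆-reflexive-↭ (↭-trans (↭-reflexive (varsᵛ-pair s₁ s₀)) (++-comm (vars s₁) (vars s₀))))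
      (s≤s (≤-reflexive (sizeᵛ-pair t₀ t₁)))
      (s≤s (≤-reflexive (trans (sizeᵛ-pair s₁ s₀) (+-comm (size s₁) (size s₀)))))

  abs-⊳ : ∀ {a b} {t t' : Term S} u u' → vars u ⊆ vars t → vars u' ⊆ vars t' →
          size u ≡ size t → size u' ≡ size t' → (abs a t ≈? abs b t') ⊳ ((u ≈? u') ∷ [])
  abs-⊳ u u' u⊆t u'⊆t' u≡t u'≡t' =
    zipC-⊳ (u ∷ []) (u' ∷ [])
      (u⊆t ∘ ⊆-reflexive (List.++-identityʳ (vars u)))
      (u'⊆t' ∘ ⊆-reflexive (List.++-identityʳ (vars u')))
      (s≤s (≤-reflexive (trans (+-identityʳ (size u)) u≡t)))
      (s≤s (≤-reflexive (trans (+-identityʳ (size u')) u'≡t')))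

  var-⊳ : ∀ π π' X → ¬ IsId π' →
          (susp π X ≈? susp π' X) ⊳ ((susp ((π' ⁻¹) ∘ₚ π) X ≈? susp [] X) ∷ [])
  var-⊳ π []      X π'≢id = contradiction (λ _ → refl) π'≢id
  var-⊳ π (_ ∷ _) X _     = record { vars-⊆ = ⊆-refl ; weight-< = n<1+n 3 }

  ↝-decreasing : ∀ {P Ps} → P ↝ Ps → All (_≺ P) Ps
  ↝-decreasing (del {Pr = Pr} {Pr'} t Pr↭) =
    subst (_⊏ Pr) (List.++-identityʳ Pr') (⊳-⊏ Pr↭ (del-⊳ t)) ∷ []
  ↝-decreasing (f g ts us Pr↭)           = ⊳-⊏ Pr↭ (f-⊳ g ts us) ∷ []
  ↝-decreasing (fC g t₀ t₁ s₀ s₁ Pr↭)    =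
    ⊳-⊏ Pr↭ (fC-⊳ g t₀ t₁ s₀ s₁) ∷ ⊳-⊏ Pr↭ (fC-swap-⊳ g t₀ t₁ s₀ s₁) ∷ []
  ↝-decreasing (absA a t t' Pr↭)         = ⊳-⊏ Pr↭ (abs-⊳ t t' ⊆-refl ⊆-refl refl refl) ∷ []
  ↝-decreasing (absAB a b t t' c₁ _ Pr↭ _ _) =
    ⊳-⊏ Pr↭ (abs-⊳ (((a , c₁) ∷ []) · t) (((b , c₁) ∷ []) · t')
                   (vars-·-⊆ _ t) (vars-·-⊆ _ t') (size-· _ t) (size-· _ t')) ∷ []
  ↝-decreasing (var π π' X π'≢id Pr↭)    = ⊳-⊏ Pr↭ (var-⊳ π π' X π'≢id) ∷ []
  ↝-decreasing (inst₁ π X t X∉t Pr↭)     =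
    eliminate-⊏ Pr↭ (here refl) (there ∘ vars-·-⊆ (π ⁻¹) t) (X∉t ∘ vars-·-⊆ (π ⁻¹) t) ∷ []
  ↝-decreasing (inst₂ π X t X∉t Pr↭)     =
    eliminate-⊏ Pr↭ (∈-++⁺ʳ (vars t) (here refl))
                (∈-++⁺ˡ ∘ vars-·-⊆ (π ⁻¹) t) (X∉t ∘ vars-·-⊆ (π ⁻¹) t) ∷ []

theorem3 : (S : Signature) → WellFounded (flip (_⟹_ {S}))
theorem3 S = Subrelation.wellFounded ⟹⇒⇒ (⇒-wellFounded ≺-wellFounded ↝-decreasing)
  where
  open Replacement (_↝_ {S})
  ⟹⇒⇒ : ∀ {E F} → E ⟹ F → E ⇒ F
  ⟹⇒⇒ (step E↭ r) = replace E↭ r
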